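{- For every integer $n>0$, let $b=\lfloor \log_2 n\rfloor$ and $c=n+1-2^{b}$ (so $1\le c\le 2^b$). Then $d_3(n)=6c-3$.
   Context: A P-position of the game of Nim with $k$ piles is a $k$-tuple $(p_1,\dots,p_k)$ of non-negative integers (piles of size $0$ allowed) whose nim-sum $p_1\oplus p_2\oplus\cdots\oplus p_k$ is $0$, where $\oplus$ denotes bitwise XOR of binary representations. $d_k(n)$ denotes the number of P-positions with $k$ piles whose largest pile has exactly $n$ counters (i.e. $\max_i p_i=n$). -}

module Defs where

open import Data.Nat using (ℕ; zero; suc; _+_; _*_; _⊔_; _/_; _%_; _≡ᵇ_)
open import Data.Bool using (Bool; true; false; if_then_else_; _∧_)
open import Data.List using (List; []; _∷_; length; filter; upTo; concatMap; map)
open import Data.Product using (_×_; _,_)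
open import Relation.Binary.PropositionalEquality using (_≡_)
open import Relation.Nullary.Decidable using (Dec; yes; no)
open import Data.Nat using (_≟_)

-- Binary digits, least significant first; k = fuel (number of digits produced).
bits : ℕ → ℕ → List Bool
bits zero    n = []
bits (suc k) n = (n % 2 ≡ᵇ 1) ∷ bits k (n / 2)

fromBits : List Bool → ℕ
fromBits []       = 0
fromBits (b ∷ bs) = (if b then 1 else 0) + 2 * fromBits bs

xorBits : List Bool → List Bool → List Bool
xorBits []       ys       = ys
xorBits xs       []       = xs
xorBits (x ∷ xs) (y ∷ ys) = (x Data.Bool.xor y) ∷ xorBits xs ys

-- Bitwise XOR (nim-sum) of natural numbers. Using m + n digits is enough
-- since a number k has at most k binary digits.
_⊕_ : ℕ → ℕ → ℕ
m ⊕ n = fromBits (xorBits (bits (m + n) m) (bits (m + n) n))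
infixl 6 _⊕_

triplesUpTo : ℕ → List (ℕ × ℕ × ℕ)
triplesUpTo n = concatMap (λ a → concatMap (λ b → map (λ c → (a , b , c)) (upTo (suc n))) (upTo (suc n))) (upTo (suc n))

isPPosMax : ℕ → ℕ × ℕ × ℕ → Bool
isPPosMax n (a , b , c) = ((a ⊕ b) ⊕ c ≡ᵇ 0) ∧ ((a Data.Nat.⊔ b) Data.Nat.⊔ c ≡ᵇ n)

count : {A : Set} → (A → Bool) → List A → ℕ
count p []       = 0
count p (x ∷ xs) = (if p x then 1 else 0) + count p xs

-- d₃(n): number of P-positions of 3-pile Nim whose largest pile is exactly n.
d₃ : ℕ → ℕ
d₃ n = count (isPPosMax n) (triplesUpTo n)

module Submission where

-- Write n = 2^B + r with r < 2^B. The third pile of a P-position is the nim-sum of the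
-- other two, so d₃ n counts the pairs (a, b) with max(a, b, a ⊕ b) = n. Exactly two of the
-- three piles lie in [2^B, n], and removing 2^B from them leaves a pair in [0, r]² with
-- maximum r (for a < 2^B ≤ b = 2^B + b′ this pair is (b′, a ⊕ b′), and a ↦ a ⊕ b′ permutes
-- [0, 2^B)). So each of the three choices of the small pile contributes (r + 1)² − r² = 2r + 1
-- positions, and d₃ n = 3 (2r + 1) = 6c − 3 with c = r + 1.

open import Defs
open import Data.Bool using (Bool; true; false; if_then_else_; _xor_)
open import Data.Bool.Properties using (xor-comm; xor-assoc; xor-same; xor-identityʳ)
open import Data.List using (List; []; _∷_; _++_; applyUpTo; upTo; concatMap; map)
open import Data.Nat
open import Data.Nat.DivMod
open import Data.Nat.Logarithm using (⌊log₂_⌋; ⌊log₂⌋-mono-≤; ⌊log₂⌊n/2⌋⌋≡⌊log₂n⌋∸1)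
open import Data.Nat.Properties
open import Data.Nat.Tactic.RingSolver using (solve-∀)
open import Data.Product using (_×_; _,_; proj₁; proj₂)
open import Function using (_∘_; id)
open import Relation.Binary.PropositionalEquality
open import Relation.Nullary using (yes; no; contradiction)
open import Relation.Nullary.Decidable using (dec-true; dec-false)

⟦_⟧ : Bool → ℕ
⟦ b ⟧ = if b then 1 else 0

bit : ℕ → Bool
bit m = m % 2 ≡ᵇ 1

≡ᵇ-true : ∀ {m n} → m ≡ n → (m ≡ᵇ n) ≡ true
≡ᵇ-true {m} {n} = dec-true (m ≟ n)

≡ᵇ-false : ∀ {m n} → m ≢ n → (m ≡ᵇ n) ≡ false
≡ᵇ-false {m} {n} = dec-false (m ≟ n)

+-cancelˡ-≡ᵇ : ∀ t m n → (t + m ≡ᵇ t + n) ≡ (m ≡ᵇ n)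
+-cancelˡ-≡ᵇ zero    m n = refl
+-cancelˡ-≡ᵇ (suc t) m n = +-cancelˡ-≡ᵇ t m n

[2+m]/2≡1+m/2 : ∀ m → (2 + m) / 2 ≡ suc (m / 2)
[2+m]/2≡1+m/2 m = m/n≡1+[m∸n]/n {2 + m} {2} (s≤s (s≤s z≤n))

[2+m]%2≡m%2 : ∀ m → (2 + m) % 2 ≡ m % 2
[2+m]%2≡m%2 m = trans (cong (_% 2) (+-comm 2 m)) ([m+n]%n≡m%n m 2)

m≡bit+2*[m/2] : ∀ m → m ≡ ⟦ bit m ⟧ + 2 * (m / 2)
m≡bit+2*[m/2] zero = refl
m≡bit+2*[m/2] (suc zero) = refl
m≡bit+2*[m/2] (suc (suc m)) rewrite [2+m]/2≡1+m/2 m | [2+m]%2≡m%2 m =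
  trans (cong (2 +_) (m≡bit+2*[m/2] m)) (shift ⟦ bit m ⟧ (m / 2))
  where
  shift : ∀ β q → 2 + (β + 2 * q) ≡ β + 2 * suc q
  shift = solve-∀

bit-[β+2q] : ∀ β q → bit (⟦ β ⟧ + 2 * q) ≡ β
bit-[β+2q] β q = trans (cong (_≡ᵇ 1) [β+2q]%2≡β%2) (β%2 β)
  where
  [β+2q]%2≡β%2 : (⟦ β ⟧ + 2 * q) % 2 ≡ ⟦ β ⟧ % 2
  [β+2q]%2≡β%2 = trans (cong (λ z → (⟦ β ⟧ + z) % 2) (*-comm 2 q)) ([m+kn]%n≡m%n ⟦ β ⟧ q 2)
  β%2 : ∀ β → (⟦ β ⟧ % 2 ≡ᵇ 1) ≡ β
  β%2 false = refl
  β%2 true  = refl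

[β+2q]/2≡q : ∀ β q → (⟦ β ⟧ + 2 * q) / 2 ≡ q
[β+2q]/2≡q β q = *-cancelˡ-≡ (m / 2) q 2 (+-cancelˡ-≡ ⟦ β ⟧ _ _ (begin
    ⟦ β ⟧ + 2 * (m / 2)      ≡⟨ cong (λ b → ⟦ b ⟧ + 2 * (m / 2)) (bit-[β+2q] β q) ⟨
    ⟦ bit m ⟧ + 2 * (m / 2)  ≡⟨ m≡bit+2*[m/2] m ⟨
    m                        ∎))
  where
  open ≡-Reasoning
  m = ⟦ β ⟧ + 2 * q

m≤1+k⇒m/2≤k : ∀ {m k} → m ≤ suc k → m / 2 ≤ k
m≤1+k⇒m/2≤k {m} {k} m≤ = ≤-trans (/-monoˡ-≤ 2 m≤) ([1+k]/2≤k k)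
  where
  [1+k]/2≤k : ∀ k → suc k / 2 ≤ k
  [1+k]/2≤k zero = z≤n
  [1+k]/2≤k (suc k) = ≤-trans (≤-reflexive ([2+m]/2≡1+m/2 k)) (s≤s (m/n≤m k 2))

xorUpTo : ℕ → ℕ → ℕ → ℕ
xorUpTo k m n = fromBits (xorBits (bits k m) (bits k n))

xorUpTo-0-0 : ∀ k → xorUpTo k 0 0 ≡ 0
xorUpTo-0-0 zero    = refl
xorUpTo-0-0 (suc k) = cong (2 *_) (xorUpTo-0-0 k)

xorUpTo-fuel-irrelevant : ∀ k k′ {m n} → m ≤ k → n ≤ k → m ≤ k′ → n ≤ k′ →
                          xorUpTo k m n ≡ xorUpTo k′ m n
xorUpTo-fuel-irrelevant zero k′ z≤n z≤n _ _ = sym (xorUpTo-0-0 k′)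
xorUpTo-fuel-irrelevant (suc k) zero z≤n z≤n _ _ = cong (2 *_) (xorUpTo-0-0 k)
xorUpTo-fuel-irrelevant (suc k) (suc k′) {m} {n} m≤k n≤k m≤k′ n≤k′ =
  cong (λ z → ⟦ bit m xor bit n ⟧ + 2 * z)
    (xorUpTo-fuel-irrelevant k k′ (m≤1+k⇒m/2≤k m≤k) (m≤1+k⇒m/2≤k n≤k)
                                   (m≤1+k⇒m/2≤k m≤k′) (m≤1+k⇒m/2≤k n≤k′))

⊕-step : ∀ x y → x ⊕ y ≡ ⟦ bit x xor bit y ⟧ + 2 * (x / 2 ⊕ y / 2)
⊕-step x y with x + y in x+y≡
... | zero rewrite m+n≡0⇒m≡0 x x+y≡ | m+n≡0⇒n≡0 x x+y≡ = refl
... | suc k = cong (λ z → ⟦ bit x xor bit y ⟧ + 2 * z)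
      (xorUpTo-fuel-irrelevant k (x / 2 + y / 2) (m≤1+k⇒m/2≤k x≤) (m≤1+k⇒m/2≤k y≤)
                                                 (m≤m+n (x / 2) (y / 2)) (m≤n+m (y / 2) (x / 2)))
  where
  x≤ : x ≤ suc k
  x≤ = subst (x ≤_) x+y≡ (m≤m+n x y)
  y≤ : y ≤ suc k
  y≤ = subst (y ≤_) x+y≡ (m≤n+m y x)

bit-⊕ : ∀ x y → bit (x ⊕ y) ≡ bit x xor bit y
bit-⊕ x y = trans (cong bit (⊕-step x y)) (bit-[β+2q] (bit x xor bit y) (x / 2 ⊕ y / 2))

[x⊕y]/2 : ∀ x y → (x ⊕ y) / 2 ≡ x / 2 ⊕ y / 2
[x⊕y]/2 x y = trans (cong (_/ 2) (⊕-step x y)) ([β+2q]/2≡q (bit x xor bit y) (x / 2 ⊕ y / 2))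

halving-ind : (P : ℕ → ℕ → Set) → P 0 0 → (∀ x y → P (x / 2) (y / 2) → P x y) → ∀ x y → P x y
halving-ind P base step x y = go (x + y) (m≤m+n x y) (m≤n+m y x)
  where
  go : ∀ k {x y} → x ≤ k → y ≤ k → P x y
  go zero    z≤n z≤n = base
  go (suc k) {x} {y} x≤ y≤ = step x y (go k (m≤1+k⇒m/2≤k x≤) (m≤1+k⇒m/2≤k y≤))

⊕-comm : ∀ x y → x ⊕ y ≡ y ⊕ x
⊕-comm = halving-ind (λ x y → x ⊕ y ≡ y ⊕ x) refl λ x y ih →
  begin
    x ⊕ y                                    ≡⟨ ⊕-step x y ⟩
    ⟦ bit x xor bit y ⟧ + 2 * (x / 2 ⊕ y / 2) ≡⟨ cong₂ (λ β z → ⟦ β ⟧ + 2 * z)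
                                                       (xor-comm (bit x) (bit y)) ih ⟩
    ⟦ bit y xor bit x ⟧ + 2 * (y / 2 ⊕ x / 2) ≡⟨ ⊕-step y x ⟨
    y ⊕ x                                    ∎
  where open ≡-Reasoning

0⊕x≡x : ∀ x → 0 ⊕ x ≡ x
0⊕x≡x x = halving-ind (λ _ y → 0 ⊕ y ≡ y) refl step x x
  where
  step : ∀ x y → 0 ⊕ y / 2 ≡ y / 2 → 0 ⊕ y ≡ y
  step _ y ih = trans (⊕-step 0 y) (trans (cong (λ z → ⟦ bit y ⟧ + 2 * z) ih) (sym (m≡bit+2*[m/2] y)))

x⊕y⊕y≡x : ∀ x y → x ⊕ y ⊕ y ≡ x
x⊕y⊕y≡x = halving-ind (λ x y → x ⊕ y ⊕ y ≡ x) refl λ x y ih →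
  begin
    x ⊕ y ⊕ y
      ≡⟨ ⊕-step (x ⊕ y) y ⟩
    ⟦ bit (x ⊕ y) xor bit y ⟧ + 2 * ((x ⊕ y) / 2 ⊕ y / 2)
      ≡⟨ cong₂ (λ β z → ⟦ β xor bit y ⟧ + 2 * (z ⊕ y / 2)) (bit-⊕ x y) ([x⊕y]/2 x y) ⟩
    ⟦ (bit x xor bit y) xor bit y ⟧ + 2 * (x / 2 ⊕ y / 2 ⊕ y / 2)
      ≡⟨ cong₂ (λ β z → ⟦ β ⟧ + 2 * z) (xor-cancel (bit x) (bit y)) ih ⟩
    ⟦ bit x ⟧ + 2 * (x / 2)
      ≡⟨ m≡bit+2*[m/2] x ⟨
    x ∎
  where
  open ≡-Reasoning
  xor-cancel : ∀ a b → (a xor b) xor b ≡ a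
  xor-cancel a b = trans (xor-assoc a b b) (trans (cong (a xor_) (xor-same b)) (xor-identityʳ a))

x⊕x≡0 : ∀ x → x ⊕ x ≡ 0
x⊕x≡0 x = trans (cong (λ z → z ⊕ x) (sym (0⊕x≡x x))) (x⊕y⊕y≡x 0 x)

x⊕y≡0⇒x≡y : ∀ {x y} → x ⊕ y ≡ 0 → x ≡ y
x⊕y≡0⇒x≡y {x} {y} eq = trans (sym (x⊕y⊕y≡x x y)) (trans (cong (_⊕ y) eq) (0⊕x≡x y))

β+2w<2T : ∀ β {w T} → w < T → ⟦ β ⟧ + 2 * w < 2 * T
β+2w<2T β {w} {T} w<T = begin-strict
    ⟦ β ⟧ + 2 * w  <⟨ s≤s (+-monoˡ-≤ (2 * w) (⟦β⟧≤1 β)) ⟩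
    2 + 2 * w      ≡⟨ *-suc 2 w ⟨
    2 * suc w      ≤⟨ *-monoʳ-≤ 2 w<T ⟩
    2 * T          ∎
  where
  open ≤-Reasoning
  ⟦β⟧≤1 : ∀ β → ⟦ β ⟧ ≤ 1
  ⟦β⟧≤1 false = z≤n
  ⟦β⟧≤1 true  = s≤s z≤n

m<2*T⇒m/2<T : ∀ {m T} → m < 2 * T → m / 2 < T
m<2*T⇒m/2<T {m} {T} m< = m<n*o⇒m/o<n (subst (m <_) (*-comm 2 T) m<)

⊕-< : ∀ B {x y} → x < 2 ^ B → y < 2 ^ B → x ⊕ y < 2 ^ B
⊕-< zero (s≤s z≤n) (s≤s z≤n) = s≤s z≤n
⊕-< (suc B) {x} {y} x< y< rewrite ⊕-step x y =
  β+2w<2T (bit x xor bit y) (⊕-< B (m<2*T⇒m/2<T x<) (m<2*T⇒m/2<T y<))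

2m+x≡bit+2*[m+x/2] : ∀ m x → 2 * m + x ≡ ⟦ bit x ⟧ + 2 * (m + x / 2)
2m+x≡bit+2*[m+x/2] m x = trans (cong (2 * m +_) (m≡bit+2*[m/2] x)) (shift m ⟦ bit x ⟧ (x / 2))
  where
  shift : ∀ m β h → 2 * m + (β + 2 * h) ≡ β + 2 * (m + h)
  shift = solve-∀

bit-[2m+x] : ∀ m x → bit (2 * m + x) ≡ bit x
bit-[2m+x] m x = trans (cong bit (2m+x≡bit+2*[m+x/2] m x)) (bit-[β+2q] (bit x) (m + x / 2))

[2m+x]/2 : ∀ m x → (2 * m + x) / 2 ≡ m + x / 2
[2m+x]/2 m x = trans (cong (_/ 2) (2m+x≡bit+2*[m+x/2] m x)) ([β+2q]/2≡q (bit x) (m + x / 2))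

⊕-split : ∀ B a b {x y} → x < 2 ^ B → y < 2 ^ B →
          (2 ^ B * a + x) ⊕ (2 ^ B * b + y) ≡ 2 ^ B * (a ⊕ b) + (x ⊕ y)
⊕-split zero a b (s≤s z≤n) (s≤s z≤n) =
  trans (cong₂ _⊕_ (1*c+0≡c a) (1*c+0≡c b)) (sym (1*c+0≡c (a ⊕ b)))
  where
  1*c+0≡c : ∀ c → 1 * c + 0 ≡ c
  1*c+0≡c c = trans (+-identityʳ (1 * c)) (*-identityˡ c)
⊕-split (suc B) a b {x} {y} x< y< = begin
    (2 * T * a + x) ⊕ (2 * T * b + y)
      ≡⟨ ⊕-step (2 * T * a + x) (2 * T * b + y) ⟩
    ⟦ bit (2 * T * a + x) xor bit (2 * T * b + y) ⟧ + 2 * ((2 * T * a + x) / 2 ⊕ (2 * T * b + y) / 2)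
      ≡⟨ cong₂ (λ β z → ⟦ β ⟧ + 2 * z) (cong₂ _xor_ (low a x) (low b y))
                                       (cong₂ _⊕_ (high a x) (high b y)) ⟩
    ⟦ β ⟧ + 2 * ((T * a + x / 2) ⊕ (T * b + y / 2))
      ≡⟨ cong (λ z → ⟦ β ⟧ + 2 * z) (⊕-split B a b (m<2*T⇒m/2<T x<) (m<2*T⇒m/2<T y<)) ⟩
    ⟦ β ⟧ + 2 * (T * (a ⊕ b) + (x / 2 ⊕ y / 2))
      ≡⟨ shift T (a ⊕ b) ⟦ β ⟧ (x / 2 ⊕ y / 2) ⟩
    2 * T * (a ⊕ b) + (⟦ β ⟧ + 2 * (x / 2 ⊕ y / 2))
      ≡⟨ cong (2 * T * (a ⊕ b) +_) (⊕-step x y) ⟨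
    2 * T * (a ⊕ b) + (x ⊕ y) ∎
  where
  open ≡-Reasoning
  T = 2 ^ B
  β = bit x xor bit y
  low : ∀ a x → bit (2 * T * a + x) ≡ bit x
  low a x = trans (cong (λ z → bit (z + x)) (*-assoc 2 T a)) (bit-[2m+x] (T * a) x)
  high : ∀ a x → (2 * T * a + x) / 2 ≡ T * a + x / 2
  high a x = trans (cong (λ z → (z + x) / 2) (*-assoc 2 T a)) ([2m+x]/2 (T * a) x)
  shift : ∀ T c β h → β + 2 * (T * c + h) ≡ 2 * T * c + (β + 2 * h)
  shift = solve-∀

[2^B+x]⊕y : ∀ B {x y} → x < 2 ^ B → y < 2 ^ B → (2 ^ B + x) ⊕ y ≡ 2 ^ B + (x ⊕ y)
[2^B+x]⊕y B {x} {y} x< y< = begin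
  (2 ^ B + x) ⊕ y                  ≡⟨ cong₂ (λ u v → (u + x) ⊕ (v + y)) (*-identityʳ (2 ^ B)) (*-zeroʳ (2 ^ B)) ⟨
  (2 ^ B * 1 + x) ⊕ (2 ^ B * 0 + y) ≡⟨ ⊕-split B 1 0 x< y< ⟩
  2 ^ B * 1 + (x ⊕ y)              ≡⟨ cong (_+ (x ⊕ y)) (*-identityʳ (2 ^ B)) ⟩
  2 ^ B + (x ⊕ y)                  ∎
  where open ≡-Reasoning

[2^B+x]⊕[2^B+y] : ∀ B {x y} → x < 2 ^ B → y < 2 ^ B → (2 ^ B + x) ⊕ (2 ^ B + y) ≡ x ⊕ y
[2^B+x]⊕[2^B+y] B {x} {y} x< y< = begin
  (2 ^ B + x) ⊕ (2 ^ B + y)         ≡⟨ cong₂ (λ u v → (u + x) ⊕ (v + y)) (*-identityʳ (2 ^ B)) (*-identityʳ (2 ^ B)) ⟨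
  (2 ^ B * 1 + x) ⊕ (2 ^ B * 1 + y) ≡⟨ ⊕-split B 1 1 x< y< ⟩
  2 ^ B * 0 + (x ⊕ y)               ≡⟨ cong (_+ (x ⊕ y)) (*-zeroʳ (2 ^ B)) ⟩
  x ⊕ y                             ∎
  where open ≡-Reasoning

∑< : ℕ → (ℕ → ℕ) → ℕ
∑< zero    f = 0
∑< (suc N) f = f 0 + ∑< N (λ i → f (suc i))

infix 5 ∑<
syntax ∑< N (λ i → f) = ∑[ i < N ] f

∑-cong : ∀ N {f g : ℕ → ℕ} → (∀ i → i < N → f i ≡ g i) → ∑[ i < N ] f i ≡ ∑[ i < N ] g i
∑-cong zero    f≗g = refl
∑-cong (suc N) f≗g = cong₂ _+_ (f≗g 0 z<s) (∑-cong N (λ i i< → f≗g (suc i) (s<s i<)))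

∑-zero : ∀ N {f : ℕ → ℕ} → (∀ i → i < N → f i ≡ 0) → ∑[ i < N ] f i ≡ 0
∑-zero N f≗0 = trans (∑-cong N f≗0) (zeros N)
  where
  zeros : ∀ N → ∑[ i < N ] 0 ≡ 0
  zeros zero    = refl
  zeros (suc N) = zeros N

∑-const1 : ∀ N → ∑[ i < N ] 1 ≡ N
∑-const1 zero    = refl
∑-const1 (suc N) = cong suc (∑-const1 N)

∑-single : ∀ N {f : ℕ → ℕ} t → t < N → (∀ i → i < N → i ≢ t → f i ≡ 0) → ∑[ i < N ] f i ≡ f t
∑-single (suc N) {f} zero _ off =
  trans (cong (f 0 +_) (∑-zero N (λ i i< → off (suc i) (s<s i<) λ ()))) (+-identityʳ (f 0))
∑-single (suc N) {f} (suc t) (s≤s t<N) off =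
  trans (cong (_+ (∑[ i < N ] f (suc i))) (off 0 z<s λ ()))
        (∑-single N t t<N λ i i< i≢t → off (suc i) (s<s i<) (i≢t ∘ suc-injective))

∑-split : ∀ m k (f : ℕ → ℕ) → ∑[ i < m + k ] f i ≡ (∑[ i < m ] f i) + (∑[ i < k ] f (m + i))
∑-split zero    k f = refl
∑-split (suc m) k f = trans (cong (f 0 +_) (∑-split m k (λ i → f (suc i)))) (sym (+-assoc (f 0) _ _))

∑-distrib-+ : ∀ N (f g : ℕ → ℕ) → ∑[ i < N ] f i + g i ≡ (∑[ i < N ] f i) + (∑[ i < N ] g i)
∑-distrib-+ zero    f g = refl
∑-distrib-+ (suc N) f g =
  trans (cong (f 0 + g 0 +_) (∑-distrib-+ N (λ i → f (suc i)) (λ i → g (suc i)))) (+-+-comm (f 0) (g 0) _ _)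
  where
  +-+-comm : ∀ a b c d → a + b + (c + d) ≡ a + c + (b + d)
  +-+-comm = solve-∀

∑-comm : ∀ N M (f : ℕ → ℕ → ℕ) → ∑[ i < N ] ∑[ j < M ] f i j ≡ ∑[ j < M ] ∑[ i < N ] f i j
∑-comm zero    M f = sym (∑-zero M λ _ _ → refl)
∑-comm (suc N) M f =
  trans (cong ((∑[ j < M ] f 0 j) +_) (∑-comm N M (λ i → f (suc i))))
        (sym (∑-distrib-+ M (f 0) (λ j → ∑[ i < N ] f (suc i) j)))

∑-involution : ∀ N (σ f : ℕ → ℕ) → (∀ i → i < N → σ i < N) → (∀ i → i < N → σ (σ i) ≡ i) →
               ∑[ i < N ] f (σ i) ≡ ∑[ i < N ] f i
∑-involution N σ f σ< σσ = begin
    ∑[ i < N ] f (σ i)           ≡⟨ ∑-cong N (λ i i< → trans (∑-single N (σ i) (σ< i i<) (off-diagonal i))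
                                                            (diagonal refl)) ⟨
    ∑[ i < N ] ∑[ j < N ] δ i j  ≡⟨ ∑-comm N N δ ⟩
    ∑[ j < N ] ∑[ i < N ] δ i j  ≡⟨ ∑-cong N (λ j j< → ∑-single N (σ j) (σ< j j<) (off-diagonal′ j j<)) ⟩
    ∑[ j < N ] δ (σ j) j         ≡⟨ ∑-cong N (λ j j< → diagonal (σσ j j<)) ⟩
    ∑[ j < N ] f j               ∎
  where
  open ≡-Reasoning
  δ : ℕ → ℕ → ℕ
  δ i j = if σ i ≡ᵇ j then f j else 0
  diagonal : ∀ {i j} → σ i ≡ j → δ i j ≡ f j
  diagonal {j = j} σi≡j = cong (λ b → if b then f j else 0) (≡ᵇ-true σi≡j)
  off-diagonal : ∀ i j → j < N → j ≢ σ i → δ i j ≡ 0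
  off-diagonal i j _ j≢ = cong (λ b → if b then f j else 0) (≡ᵇ-false (j≢ ∘ sym))
  off-diagonal′ : ∀ j → j < N → ∀ i → i < N → i ≢ σ j → δ i j ≡ 0
  off-diagonal′ j _ i i< i≢ = cong (λ b → if b then f j else 0)
    (≡ᵇ-false λ σi≡j → i≢ (trans (sym (σσ i i<)) (cong σ σi≡j)))

∑-extend : ∀ {m N} (f : ℕ → ℕ) → m ≤ N → (∀ i → m ≤ i → i < N → f i ≡ 0) →
           ∑[ i < N ] f i ≡ ∑[ i < m ] f i
∑-extend {m} {N} f m≤N tail0 = begin
    ∑[ i < N ] f i                                   ≡⟨ cong (λ K → ∑< K f) (m+[n∸m]≡n m≤N) ⟨
    ∑[ i < m + (N ∸ m) ] f i                         ≡⟨ ∑-split m (N ∸ m) f ⟩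
    (∑[ i < m ] f i) + (∑[ i < N ∸ m ] f (m + i))    ≡⟨ cong ((∑[ i < m ] f i) +_) (∑-zero (N ∸ m) tail0′) ⟩
    (∑[ i < m ] f i) + 0                             ≡⟨ +-identityʳ _ ⟩
    ∑[ i < m ] f i                                   ∎
  where
  open ≡-Reasoning
  tail0′ : ∀ i → i < N ∸ m → f (m + i) ≡ 0
  tail0′ i i< = tail0 (m + i) (m≤m+n m i) (subst (m + i <_) (m+[n∸m]≡n m≤N) (+-monoʳ-< m i<))

∑²-split : ∀ m k (f : ℕ → ℕ → ℕ) →
  ∑[ i < m + k ] ∑[ j < m + k ] f i j ≡
    ((∑[ i < m ] ∑[ j < m ] f i j) + (∑[ i < m ] ∑[ j < k ] f i (m + j))) +
    ((∑[ i < k ] ∑[ j < m ] f (m + i) j) + (∑[ i < k ] ∑[ j < k ] f (m + i) (m + j)))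
∑²-split m k f = trans (∑-split m k (λ i → ∑[ j < m + k ] f i j))
                       (cong₂ _+_ (split-rows m f) (split-rows k (λ i → f (m + i))))
  where
  split-rows : ∀ N (g : ℕ → ℕ → ℕ) →
    ∑[ i < N ] ∑[ j < m + k ] g i j ≡ (∑[ i < N ] ∑[ j < m ] g i j) + (∑[ i < N ] ∑[ j < k ] g i (m + j))
  split-rows N g = trans (∑-cong N (λ i _ → ∑-split m k (g i))) (∑-distrib-+ N _ _)

∑∑[a⊔b≡r] : ∀ r → ∑[ a < suc r ] ∑[ b < suc r ] ⟦ a ⊔ b ≡ᵇ r ⟧ ≡ r + suc r
∑∑[a⊔b≡r] r = begin
    ∑[ a < suc r ] row a                    ≡⟨ cong (λ N → ∑< N row) (+-comm 1 r) ⟩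
    ∑[ a < r + 1 ] row a                    ≡⟨ ∑-split r 1 row ⟩
    (∑[ a < r ] row a) + (row (r + 0) + 0)  ≡⟨ cong₂ _+_ (trans (∑-cong r row<r) (∑-const1 r))
                                                         (trans (+-identityʳ _) (cong row (+-identityʳ r))) ⟩
    r + row r                               ≡⟨ cong (r +_) row-r ⟩
    r + suc r                               ∎
  where
  open ≡-Reasoning
  row : ℕ → ℕ
  row a = ∑[ b < suc r ] ⟦ a ⊔ b ≡ᵇ r ⟧
  row<r : ∀ a → a < r → row a ≡ 1
  row<r a a<r = trans (∑-single (suc r) r ≤-refl off) (cong ⟦_⟧ (≡ᵇ-true (m≤n⇒m⊔n≡n (<⇒≤ a<r))))
    where
    off : ∀ b → b < suc r → b ≢ r → ⟦ a ⊔ b ≡ᵇ r ⟧ ≡ 0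
    off b b≤r b≢r = cong ⟦_⟧ (≡ᵇ-false (<⇒≢ (⊔-lub a<r (≤∧≢⇒< (≤-pred b≤r) b≢r))))
  row-r : row r ≡ suc r
  row-r = trans (∑-cong (suc r) λ b b≤r → cong ⟦_⟧ (≡ᵇ-true (m≥n⇒m⊔n≡m (≤-pred b≤r))))
                (∑-const1 (suc r))

count-++ : ∀ {A : Set} (p : A → Bool) xs ys → count p (xs ++ ys) ≡ count p xs + count p ys
count-++ p []       ys = refl
count-++ p (x ∷ xs) ys = trans (cong (⟦ p x ⟧ +_) (count-++ p xs ys)) (sym (+-assoc ⟦ p x ⟧ _ _))

count-map-applyUpTo : ∀ {A : Set} (p : A → Bool) (h : ℕ → A) (g : ℕ → ℕ) N →
                      count p (map h (applyUpTo g N)) ≡ ∑[ i < N ] ⟦ p (h (g i)) ⟧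
count-map-applyUpTo p h g zero    = refl
count-map-applyUpTo p h g (suc N) = cong (⟦ p (h (g 0)) ⟧ +_) (count-map-applyUpTo p h (g ∘ suc) N)

count-concatMap-applyUpTo : ∀ {A : Set} (p : A → Bool) (h : ℕ → List A) (g : ℕ → ℕ) N →
                            count p (concatMap h (applyUpTo g N)) ≡ ∑[ i < N ] count p (h (g i))
count-concatMap-applyUpTo p h g zero    = refl
count-concatMap-applyUpTo p h g (suc N) =
  trans (count-++ p (h (g 0)) _) (cong (count p (h (g 0)) +_) (count-concatMap-applyUpTo p h (g ∘ suc) N))

d₃≡∑∑∑ : ∀ n → d₃ n ≡ ∑[ a < suc n ] ∑[ b < suc n ] ∑[ c < suc n ] ⟦ isPPosMax n (a , b , c) ⟧
d₃≡∑∑∑ n =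
  trans (count-concatMap-applyUpTo p (λ a → concatMap (λ b → map (λ c → (a , b , c)) piles) piles) id (suc n))
    (∑-cong (suc n) λ a _ →
      trans (count-concatMap-applyUpTo p (λ b → map (λ c → (a , b , c)) piles) id (suc n))
        (∑-cong (suc n) λ b _ → count-map-applyUpTo p (λ c → (a , b , c)) id (suc n)))
  where
  p = isPPosMax n
  piles = upTo (suc n)

largestPile : ℕ → ℕ → ℕ
largestPile a b = (a ⊔ b) ⊔ (a ⊕ b)

isPPosMax-≢⊕ : ∀ n a b c → c ≢ a ⊕ b → isPPosMax n (a , b , c) ≡ false
isPPosMax-≢⊕ n a b c c≢ rewrite ≡ᵇ-false {a ⊕ b ⊕ c} {0} (c≢ ∘ sym ∘ x⊕y≡0⇒x≡y) = refl

∑[isPPosMax]≡[largestPile≡n] : ∀ n a b →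
  ∑[ c < suc n ] ⟦ isPPosMax n (a , b , c) ⟧ ≡ ⟦ largestPile a b ≡ᵇ n ⟧
∑[isPPosMax]≡[largestPile≡n] n a b with a ⊕ b ≤? n
... | yes a⊕b≤n =
  trans (∑-single (suc n) (a ⊕ b) (s≤s a⊕b≤n) λ c _ c≢ → cong ⟦_⟧ (isPPosMax-≢⊕ n a b c c≢)) third-pile
  where
  third-pile : ⟦ isPPosMax n (a , b , a ⊕ b) ⟧ ≡ ⟦ largestPile a b ≡ᵇ n ⟧
  third-pile rewrite x⊕x≡0 (a ⊕ b) = refl
... | no a⊕b≰n = trans (∑-zero (suc n) λ c c≤n → cong ⟦_⟧ (isPPosMax-≢⊕ n a b c (c≢a⊕b c≤n)))
                       (sym (cong ⟦_⟧ (≡ᵇ-false largest≢n)))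
  where
  c≢a⊕b : ∀ {c} → c < suc n → c ≢ a ⊕ b
  c≢a⊕b c≤n c≡ = a⊕b≰n (subst (_≤ n) c≡ (≤-pred c≤n))
  largest≢n : largestPile a b ≢ n
  largest≢n largest≡n = a⊕b≰n (subst (a ⊕ b ≤_) largest≡n (m≤n⊔m (a ⊔ b) (a ⊕ b)))

d₃≡∑∑[largestPile≡n] : ∀ n → d₃ n ≡ ∑[ a < suc n ] ∑[ b < suc n ] ⟦ largestPile a b ≡ᵇ n ⟧
d₃≡∑∑[largestPile≡n] n =
  trans (d₃≡∑∑∑ n) (∑-cong (suc n) λ a _ → ∑-cong (suc n) λ b _ → ∑[isPPosMax]≡[largestPile≡n] n a b)

largestPile-comm : ∀ a b → largestPile a b ≡ largestPile b a
largestPile-comm a b = cong₂ _⊔_ (⊔-comm a b) (⊕-comm a b)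

module _ (B r : ℕ) (r<T : r < 2 ^ B) where

  private
    T = 2 ^ B
    n = T + r

    χ : ℕ → ℕ → ℕ
    χ a b = ⟦ largestPile a b ≡ᵇ n ⟧

    b≤r⇒b<T : ∀ {b} → b < suc r → b < T
    b≤r⇒b<T b≤r = ≤-<-trans (≤-pred b≤r) r<T

  largestPile-low-low : ∀ {a b} → a < T → b < T → largestPile a b < T
  largestPile-low-low {a} {b} a<T b<T = ⊔-lub (⊔-lub a<T b<T) (⊕-< B a<T b<T)

  largestPile-low-high : ∀ {a b} → a < T → b < T → largestPile a (T + b) ≡ T + (b ⊔ (a ⊕ b))
  largestPile-low-high {a} {b} a<T b<T = begin
      (a ⊔ (T + b)) ⊔ (a ⊕ (T + b))  ≡⟨ cong₂ _⊔_ (m≤n⇒m⊔n≡n a≤T+b) a⊕[T+b] ⟩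
      (T + b) ⊔ (T + (a ⊕ b))        ≡⟨ +-distribˡ-⊔ T b (a ⊕ b) ⟨
      T + (b ⊔ (a ⊕ b))              ∎
    where
    open ≡-Reasoning
    a≤T+b : a ≤ T + b
    a≤T+b = ≤-trans (<⇒≤ a<T) (m≤m+n T b)
    a⊕[T+b] : a ⊕ (T + b) ≡ T + (a ⊕ b)
    a⊕[T+b] = trans (⊕-comm a (T + b)) (trans ([2^B+x]⊕y B b<T a<T) (cong (T +_) (⊕-comm b a)))

  largestPile-high-high : ∀ {a b} → a < T → b < T → largestPile (T + a) (T + b) ≡ T + (a ⊔ b)
  largestPile-high-high {a} {b} a<T b<T = begin
      ((T + a) ⊔ (T + b)) ⊔ ((T + a) ⊕ (T + b))  ≡⟨ cong₂ _⊔_ (sym (+-distribˡ-⊔ T a b))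
                                                              ([2^B+x]⊕[2^B+y] B a<T b<T) ⟩
      (T + (a ⊔ b)) ⊔ (a ⊕ b)                    ≡⟨ m≥n⇒m⊔n≡m a⊕b≤T+[a⊔b] ⟩
      T + (a ⊔ b)                                ∎
    where
    open ≡-Reasoning
    a⊕b≤T+[a⊔b] : a ⊕ b ≤ T + (a ⊔ b)
    a⊕b≤T+[a⊔b] = ≤-trans (<⇒≤ (⊕-< B a<T b<T)) (m≤m+n T (a ⊔ b))

  private
    χ-low-high : ∀ {a b} → a < T → b < suc r → χ a (T + b) ≡ ⟦ b ⊔ (a ⊕ b) ≡ᵇ r ⟧
    χ-low-high a<T b≤r =
      cong ⟦_⟧ (trans (cong (_≡ᵇ n) (largestPile-low-high a<T (b≤r⇒b<T b≤r))) (+-cancelˡ-≡ᵇ T _ r))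

    χ-high-high : ∀ {a b} → a < suc r → b < suc r → χ (T + a) (T + b) ≡ ⟦ a ⊔ b ≡ᵇ r ⟧
    χ-high-high a≤r b≤r =
      cong ⟦_⟧ (trans (cong (_≡ᵇ n) (largestPile-high-high (b≤r⇒b<T a≤r) (b≤r⇒b<T b≤r)))
                      (+-cancelˡ-≡ᵇ T _ r))

  ∑∑-low-low : ∑[ a < T ] ∑[ b < T ] χ a b ≡ 0
  ∑∑-low-low = ∑-zero T λ a a<T → ∑-zero T λ b b<T → cong ⟦_⟧ (≡ᵇ-false λ lp≡n →
    <⇒≱ (largestPile-low-low a<T b<T) (subst (T ≤_) (sym lp≡n) (m≤m+n T r)))

  ∑∑-low-high : ∑[ a < T ] ∑[ b < suc r ] χ a (T + b) ≡ r + suc r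
  ∑∑-low-high = begin
      ∑[ a < T ] ∑[ b < suc r ] χ a (T + b)           ≡⟨ ∑-cong T (λ a a<T → ∑-cong (suc r) λ b → χ-low-high a<T) ⟩
      ∑[ a < T ] ∑[ b < suc r ] ⟦ b ⊔ (a ⊕ b) ≡ᵇ r ⟧   ≡⟨ ∑-comm T (suc r) (λ a b → ⟦ b ⊔ (a ⊕ b) ≡ᵇ r ⟧) ⟩
      ∑[ b < suc r ] ∑[ a < T ] ⟦ b ⊔ (a ⊕ b) ≡ᵇ r ⟧   ≡⟨ ∑-cong (suc r) substitute ⟩
      ∑[ b < suc r ] ∑[ c < T ] ⟦ b ⊔ c ≡ᵇ r ⟧         ≡⟨ ∑-cong (suc r) (λ b _ → ∑-extend _ r<T (vanishes b)) ⟩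
      ∑[ b < suc r ] ∑[ c < suc r ] ⟦ b ⊔ c ≡ᵇ r ⟧     ≡⟨ ∑∑[a⊔b≡r] r ⟩
      r + suc r                                       ∎
    where
    open ≡-Reasoning
    substitute : ∀ b → b < suc r → ∑[ a < T ] ⟦ b ⊔ (a ⊕ b) ≡ᵇ r ⟧ ≡ ∑[ c < T ] ⟦ b ⊔ c ≡ᵇ r ⟧
    substitute b b≤r = ∑-involution T (_⊕ b) (λ c → ⟦ b ⊔ c ≡ᵇ r ⟧)
                         (λ a a<T → ⊕-< B a<T (b≤r⇒b<T b≤r)) (λ a _ → x⊕y⊕y≡x a b)
    vanishes : ∀ b c → suc r ≤ c → c < T → ⟦ b ⊔ c ≡ᵇ r ⟧ ≡ 0
    vanishes b c r<c _ = cong ⟦_⟧ (≡ᵇ-false λ b⊔c≡r → <⇒≱ r<c (subst (c ≤_) b⊔c≡r (m≤n⊔m b c)))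

  ∑∑-high-low : ∑[ a < suc r ] ∑[ b < T ] χ (T + a) b ≡ r + suc r
  ∑∑-high-low = begin
      ∑[ a < suc r ] ∑[ b < T ] χ (T + a) b  ≡⟨ ∑-cong (suc r) (λ a _ → ∑-cong T λ b _ →
                                                  cong (λ m → ⟦ m ≡ᵇ n ⟧) (largestPile-comm (T + a) b)) ⟩
      ∑[ a < suc r ] ∑[ b < T ] χ b (T + a)  ≡⟨ ∑-comm T (suc r) (λ b a → χ b (T + a)) ⟨
      ∑[ b < T ] ∑[ a < suc r ] χ b (T + a)  ≡⟨ ∑∑-low-high ⟩
      r + suc r                              ∎
    where open ≡-Reasoning

  ∑∑-high-high : ∑[ a < suc r ] ∑[ b < suc r ] χ (T + a) (T + b) ≡ r + suc r
  ∑∑-high-high = trans (∑-cong (suc r) λ a a≤r → ∑-cong (suc r) λ b → χ-high-high a≤r) (∑∑[a⊔b≡r] r)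

  d₃[2^B+r] : d₃ (2 ^ B + r) ≡ 3 * (r + suc r)
  d₃[2^B+r] = begin
      d₃ n                                           ≡⟨ d₃≡∑∑[largestPile≡n] n ⟩
      ∑[ a < suc n ] ∑[ b < suc n ] χ a b            ≡⟨ cong (λ N → ∑[ a < N ] ∑[ b < N ] χ a b) (+-suc T r) ⟨
      ∑[ a < T + suc r ] ∑[ b < T + suc r ] χ a b    ≡⟨ ∑²-split T (suc r) χ ⟩
      ((∑[ a < T ] ∑[ b < T ] χ a b) + (∑[ a < T ] ∑[ b < suc r ] χ a (T + b))) +
      ((∑[ a < suc r ] ∑[ b < T ] χ (T + a) b) + (∑[ a < suc r ] ∑[ b < suc r ] χ (T + a) (T + b)))
        ≡⟨ cong₂ _+_ (cong₂ _+_ ∑∑-low-low ∑∑-low-high) (cong₂ _+_ ∑∑-high-low ∑∑-high-high) ⟩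
      (0 + (r + suc r)) + ((r + suc r) + (r + suc r)) ≡⟨ three-blocks (r + suc r) ⟩
      3 * (r + suc r)                                ∎
    where
    open ≡-Reasoning
    three-blocks : ∀ m → (0 + m) + (m + m) ≡ 3 * m
    three-blocks = solve-∀

⌊n/2⌋≡n/2 : ∀ n → ⌊ n /2⌋ ≡ n / 2
⌊n/2⌋≡n/2 zero          = refl
⌊n/2⌋≡n/2 (suc zero)    = refl
⌊n/2⌋≡n/2 (suc (suc n)) = trans (cong suc (⌊n/2⌋≡n/2 n)) (sym ([2+m]/2≡1+m/2 n))

2^⌊log₂n⌋≤n<2^[1+⌊log₂n⌋] : ∀ n → 0 < n → 2 ^ ⌊log₂ n ⌋ ≤ n × n < 2 * 2 ^ ⌊log₂ n ⌋
2^⌊log₂n⌋≤n<2^[1+⌊log₂n⌋] n 0<n = bounds ⌊log₂ n ⌋ n refl 0<n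
  where
  bounds : ∀ L n → ⌊log₂ n ⌋ ≡ L → 0 < n → 2 ^ L ≤ n × n < 2 * 2 ^ L
  bounds zero    1                 _     _ = ≤-refl , s≤s (s≤s z≤n)
  bounds zero    n@(suc (suc _))   log≡0 _ =
    contradiction log≡0 (≢-sym (<⇒≢ (⌊log₂⌋-mono-≤ {2} {n} (s≤s (s≤s z≤n)))))
  bounds (suc L) n@(suc (suc _))   log≡  _ = lower , upper
    where
    halved : 2 ^ L ≤ ⌊ n /2⌋ × ⌊ n /2⌋ < 2 * 2 ^ L
    halved = bounds L ⌊ n /2⌋ (trans (⌊log₂⌊n/2⌋⌋≡⌊log₂n⌋∸1 n) (cong (_∸ 1) log≡)) z<s
    lower : 2 ^ suc L ≤ n
    lower = begin
      2 * 2 ^ L                  ≤⟨ *-monoʳ-≤ 2 (subst (2 ^ L ≤_) (⌊n/2⌋≡n/2 n) (proj₁ halved)) ⟩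
      2 * (n / 2)                ≤⟨ m≤n+m (2 * (n / 2)) ⟦ bit n ⟧ ⟩
      ⟦ bit n ⟧ + 2 * (n / 2)    ≡⟨ m≡bit+2*[m/2] n ⟨
      n                          ∎
      where open ≤-Reasoning
    upper : n < 2 * 2 ^ suc L
    upper = subst (_< 2 * 2 ^ suc L) (sym (m≡bit+2*[m/2] n))
                  (β+2w<2T (bit n) (subst (_< 2 * 2 ^ L) (⌊n/2⌋≡n/2 n) (proj₂ halved)))

3*[2r+1]≡6*[r+1]∸3 : ∀ r → 3 * (r + suc r) ≡ 6 * (r + 1) ∸ 3
3*[2r+1]≡6*[r+1]∸3 r = sym (trans (cong (_∸ 3) (6*[r+1]≡3+3*[2r+1] r)) (m+n∸m≡n 3 (3 * (r + suc r))))
  where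
  6*[r+1]≡3+3*[2r+1] : ∀ r → 6 * (r + 1) ≡ 3 + 3 * (r + suc r)
  6*[r+1]≡3+3*[2r+1] = solve-∀

theorem11 : (n : ℕ) → 0 < n →
    let b = ⌊log₂ n ⌋
        c = n + 1 ∸ 2 ^ b
    in d₃ n ≡ 6 * c ∸ 3
theorem11 n 0<n = begin
    d₃ n                  ≡⟨ cong d₃ (m+[n∸m]≡n T≤n) ⟨
    d₃ (T + r)            ≡⟨ d₃[2^B+r] B r r<T ⟩
    3 * (r + suc r)       ≡⟨ 3*[2r+1]≡6*[r+1]∸3 r ⟩
    6 * (r + 1) ∸ 3       ≡⟨ cong (λ c → 6 * c ∸ 3) (+-∸-comm 1 T≤n) ⟨
    6 * (n + 1 ∸ T) ∸ 3   ∎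
  where
  open ≡-Reasoning
  B = ⌊log₂ n ⌋
  T = 2 ^ B
  r = n ∸ T
  T≤n : T ≤ n
  T≤n = proj₁ (2^⌊log₂n⌋≤n<2^[1+⌊log₂n⌋] n 0<n)
  n<T+T : n < T + T
  n<T+T = subst (n <_) (cong (T +_) (+-identityʳ T)) (proj₂ (2^⌊log₂n⌋≤n<2^[1+⌊log₂n⌋] n 0<n))
  r<T : r < T
  r<T = m<n+o⇒m∸n<o n T {{m^n≢0 2 B}} n<T+T
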